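{- Let $q \geq 2$ and $l \geq 1$ be integers, and let $m_0, m_1, m_2, m_3$ be positive real numbers with $$1 \leq m_0, m_2, m_3 < q, \qquad 0 < m_1 < l^{ -1}(6q)^{ -l}.$$ Let $t(x) = m_3 x^3 + m_2 x^2 - m_1 x + m_0$ and write $t(x)^l = \sum_{i=0}^{3l} c_i x^i$. Then $c_i > 0$ for $i = 0, 2, 3, \ldots, 3l$, and $c_1 < 0$. Moreover, $|c_i| \leq (4q)^l$ for all $i = 0, 1, \ldots, 3l$. -}

module Defs where

open import Level using (Level; _⊔_) renaming (suc to lsuc)
open import Algebra.Bundles using (CommutativeRing)
open import Data.Nat using (ℕ; zero; suc)
open import Data.List using (List; []; _∷_; map)
open import Data.Product using (∃; _×_)
open import Data.Sum using (_⊎_)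
open import Relation.Nullary using (¬_)

-- An ordered field: a commutative ring with multiplicative inverses of
-- nonzero elements and a strict total order compatible with + and *.
-- (The real numbers are an instance; the paper's statement is over ℝ.)
record OrderedField (c ℓ : Level) : Set (lsuc (c ⊔ ℓ)) where
  field
    commutativeRing : CommutativeRing c ℓ
  open CommutativeRing commutativeRing public
  infix 4 _<_
  field
    _<_          : Carrier → Carrier → Set ℓ
    <-irrefl     : ∀ {x} → ¬ (x < x)
    <-trans      : ∀ {x y z} → x < y → y < z → x < z
    <-trichotomy : ∀ x y → x < y ⊎ x ≈ y ⊎ y < x
    <-respˡ-≈    : ∀ {x y z} → x ≈ y → x < z → y < z
    <-respʳ-≈    : ∀ {x y z} → y ≈ z → x < y → x < z
    +-monoˡ-<    : ∀ {x y} z → x < y → x + z < y + z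
    *-pos        : ∀ {x y} → 0# < x → 0# < y → 0# < x * y
    0<1          : 0# < 1#
    inverse      : ∀ x → ¬ (x ≈ 0#) → ∃ λ y → x * y ≈ 1#

module _ {c ℓ : Level} (F : OrderedField c ℓ) where
  open OrderedField F

  infix 4 _≤_
  _≤_ : Carrier → Carrier → Set ℓ
  x ≤ y = x < y ⊎ x ≈ y

  AbsLe : Carrier → Carrier → Set ℓ
  AbsLe x y = (- y ≤ x) × (x ≤ y)

  fromℕ : ℕ → Carrier
  fromℕ zero    = 0#
  fromℕ (suc n) = 1# + fromℕ n

  pow : Carrier → ℕ → Carrier
  pow x zero    = 1#
  pow x (suc n) = x * pow x n

  -- Polynomials as coefficient lists, lowest degree first: a₀ ∷ a₁ ∷ ...
  Poly : Set c
  Poly = List Carrier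

  addP : Poly → Poly → Poly
  addP []       q        = q
  addP (a ∷ p)  []       = a ∷ p
  addP (a ∷ p)  (b ∷ q)  = (a + b) ∷ addP p q

  mulP : Poly → Poly → Poly
  mulP []      q = []
  mulP (a ∷ p) q = addP (map (a *_) q) (0# ∷ mulP p q)

  powP : Poly → ℕ → Poly
  powP p zero    = 1# ∷ []
  powP p (suc n) = mulP p (powP p n)

  coeff : Poly → ℕ → Carrier
  coeff []      i       = 0#
  coeff (a ∷ p) zero    = a
  coeff (a ∷ p) (suc i) = coeff p i

  tPoly : Carrier → Carrier → Carrier → Carrier → Poly
  tPoly m₀ m₁ m₂ m₃ = m₀ ∷ (- m₁) ∷ m₂ ∷ m₃ ∷ []

{-# OPTIONS --safe #-}
-- Write t = s − m₁x with s = m₀ + m₂x² + m₃x³ and put K = 4q.  Multiplying a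
-- coefficient sequence by t adds four shifted copies with weights of size at
-- most q, so every coefficient of tⁿ has absolute value at most Kⁿ.  For the
-- signs, compare tⁿ with χₙ, the indicator of the positions 0, 2, 3, …, 3n where
-- sⁿ has coefficients ≥ 1: every coefficient of tⁿ is at least χₙ − m₁nKⁿ.  In
-- the inductive step the weights m₀, m₂, m₃ ≥ 1 carry χₙ over to χₙ₊₁, the term
-- −m₁x costs at most m₁Kⁿ, and the four errors add up to at most
-- K(m₁Kⁿ + m₁nKⁿ) = m₁(n+1)Kⁿ⁺¹, which the hypothesis on m₁ keeps below 1 at
-- n = l.  The constant coefficient m₀ⁿ stays positive and the linear one gains
-- −m₁ times it at every step, so it is negative.
module Submission where

open import Defs hiding (_≤_)
open import Level using (Level)
open import Data.Nat using (ℕ; zero; suc; s≤s; z≤n) renaming (_≤_ to _≤ℕ_; _*_ to _*ℕ_)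
open import Data.Nat.Properties using (m≤m+n)
open import Data.List using ([]; _∷_; map)
open import Data.Product using (_×_; _,_; proj₁; proj₂; ∃-syntax)
open import Data.Sum using (_⊎_; inj₁; inj₂)
open import Relation.Binary.Structures using (IsStrictPartialOrder)
open import Relation.Binary.Bundles using (StrictPartialOrder)
open import Relation.Nullary using (Dec; yes; no; contradiction)
open import Relation.Nullary.Decidable using (_⊎-dec_; _×-dec_)
import Relation.Binary.Construct.StrictToNonStrict as StrictToNonStrict
import Relation.Binary.Reasoning.StrictPartialOrder as ≤-Reasoning
import Algebra.Properties.Ring as RingProperties
import Algebra.Properties.CommutativeSemigroup as CommutativeSemigroupProperties
import Algebra.Solver.Ring.NaturalCoefficients.Default as SemiringSolver

module PositiveIndices where
  open import Data.Nat using (_+_; s≤s⁻¹; _≟_; _≤?_)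
  open import Data.Nat.Properties using (*-suc; m≤n⇒m<n∨m≡n) renaming (≤-refl to ≤ℕ-refl)
  open import Relation.Binary.PropositionalEquality using (_≡_; refl; sym; subst)

  PosIndex : ℕ → ℕ → Set
  PosIndex n j = j ≡ 0 ⊎ (2 ≤ℕ j × j ≤ℕ 3 *ℕ n)

  posIndex? : ∀ n j → Dec (PosIndex n j)
  posIndex? n j = (j ≟ 0) ⊎-dec ((2 ≤? j) ×-dec (j ≤? 3 *ℕ n))

  PosIndex-3* : ∀ n → PosIndex n (3 *ℕ n)
  PosIndex-3* zero    = inj₁ refl
  PosIndex-3* (suc n) = inj₂ (subst (2 ≤ℕ_) (sym (*-suc 3 n)) (s≤s (s≤s z≤n)) , ≤ℕ-refl)

  PosIndex-or-pred : ℕ → ℕ → Set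
  PosIndex-or-pred n j = PosIndex n j ⊎ ∃[ k ] (j ≡ suc k × PosIndex n k)

  ≤3*⇒PosIndex-or-pred : ∀ {n j} → j ≤ℕ 3 *ℕ n → PosIndex-or-pred n j
  ≤3*⇒PosIndex-or-pred {j = zero}        _    = inj₁ (inj₁ refl)
  ≤3*⇒PosIndex-or-pred {j = suc zero}    _    = inj₂ (0 , refl , inj₁ refl)
  ≤3*⇒PosIndex-or-pred {j = suc (suc _)} j≤3n = inj₁ (inj₂ (s≤s (s≤s z≤n) , j≤3n))

  -- A position ≥ 2 of t^(n+1) is a position of t^n moved up by x² or by x³.
  PosIndex-suc⁻¹ : ∀ {n j} → PosIndex (suc n) (2 + j) → PosIndex-or-pred n j
  PosIndex-suc⁻¹ {n} {j} (inj₂ (_ , 2+j≤3[1+n]))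
    with m≤n⇒m<n∨m≡n (s≤s⁻¹ (s≤s⁻¹ (subst (2 + j ≤ℕ_) (*-suc 3 n) 2+j≤3[1+n])))
  ... | inj₁ (s≤s j≤3n) = ≤3*⇒PosIndex-or-pred {n} j≤3n
  ... | inj₂ j≡1+3n     = inj₂ (3 *ℕ n , j≡1+3n , PosIndex-3* n)

open PositiveIndices

module OrderedFieldProperties {c ℓ : Level} (F : OrderedField c ℓ) where
  open OrderedField F
  open RingProperties ring using (-‿distribʳ-*; -‿involutive; -‿+-comm; -0#≈0#; x[y-z]≈xy-xz; //-rightDividesˡ; //-rightDividesʳ; xyx⁻¹≈y)
  open CommutativeSemigroupProperties +-commutativeSemigroup using (interchange)

  <-isStrictPartialOrder : IsStrictPartialOrder _≈_ _<_
  <-isStrictPartialOrder = record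
    { isEquivalence = isEquivalence
    ; irrefl        = λ x≈y x<y → <-irrefl (<-respʳ-≈ (sym x≈y) x<y)
    ; trans         = <-trans
    ; <-resp-≈      = <-respʳ-≈ , <-respˡ-≈
    }

  <-strictPartialOrder : StrictPartialOrder c ℓ ℓ
  <-strictPartialOrder = record { isStrictPartialOrder = <-isStrictPartialOrder }

  -- Definitionally Defs._≤_ F, so results transfer to the statement unchanged.
  open StrictToNonStrict _≈_ _<_ public using (_≤_; <⇒≤)
  open ≤-Reasoning <-strictPartialOrder public

  ≤-refl : ∀ {x} → x ≤ x
  ≤-refl = inj₂ refl

  ≤-trans : ∀ {x y z} → x ≤ y → y ≤ z → x ≤ z
  ≤-trans = StrictToNonStrict.trans _≈_ _<_ isEquivalence (<-respʳ-≈ , <-respˡ-≈) <-trans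

  0≤1 : 0# ≤ 1#
  0≤1 = inj₁ 0<1

  1≤⇒0≤ : ∀ {x} → 1# ≤ x → 0# ≤ x
  1≤⇒0≤ = ≤-trans 0≤1

  +-monoʳ-< : ∀ {x y} z → x < y → z + x < z + y
  +-monoʳ-< {x} {y} z x<y = begin-strict
    z + x  ≈⟨ +-comm z x ⟩
    x + z  <⟨ +-monoˡ-< z x<y ⟩
    y + z  ≈⟨ +-comm y z ⟩
    z + y  ∎

  +-monoˡ-≤ : ∀ {x y} z → x ≤ y → x + z ≤ y + z
  +-monoˡ-≤ z (inj₁ x<y) = inj₁ (+-monoˡ-< z x<y)
  +-monoˡ-≤ z (inj₂ x≈y) = inj₂ (+-congʳ x≈y)

  +-monoʳ-≤ : ∀ {x y} z → x ≤ y → z + x ≤ z + y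
  +-monoʳ-≤ z (inj₁ x<y) = inj₁ (+-monoʳ-< z x<y)
  +-monoʳ-≤ z (inj₂ x≈y) = inj₂ (+-congˡ x≈y)

  +-mono-≤ : ∀ {a b x y} → a ≤ b → x ≤ y → a + x ≤ b + y
  +-mono-≤ {b = b} {x} a≤b x≤y = ≤-trans (+-monoˡ-≤ x a≤b) (+-monoʳ-≤ b x≤y)

  +-mono-≤-< : ∀ {a b x y} → a ≤ b → x < y → a + x < b + y
  +-mono-≤-< {a} {b} {x} {y} a≤b x<y = begin-strict
    a + x  ≤⟨ +-monoˡ-≤ x a≤b ⟩
    b + x  <⟨ +-monoʳ-< b x<y ⟩
    b + y  ∎

  x≤x+y : ∀ {x y} → 0# ≤ y → x ≤ x + y
  x≤x+y {x} {y} 0≤y = begin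
    x       ≈⟨ +-identityʳ x ⟨
    x + 0#  ≤⟨ +-monoʳ-≤ x 0≤y ⟩
    x + y   ∎

  x≤y+x : ∀ {x y} → 0# ≤ y → x ≤ y + x
  x≤y+x {x} {y} 0≤y = begin
    x       ≈⟨ +-identityˡ x ⟨
    0# + x  ≤⟨ +-monoˡ-≤ x 0≤y ⟩
    y + x   ∎

  +-nonNeg : ∀ {x y} → 0# ≤ x → 0# ≤ y → 0# ≤ x + y
  +-nonNeg 0≤x 0≤y = ≤-trans 0≤x (x≤x+y 0≤y)

  +-cancelʳ-< : ∀ {x y} z → x + z < y + z → x < y
  +-cancelʳ-< {x} {y} z x+z<y+z = begin-strict
    x            ≈⟨ //-rightDividesʳ z x ⟨
    x + z - z    <⟨ +-monoˡ-< (- z) x+z<y+z ⟩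
    y + z - z    ≈⟨ //-rightDividesʳ z y ⟩
    y            ∎

  <⇒0<- : ∀ {x y} → x < y → 0# < y - x
  <⇒0<- {x} {y} x<y = begin-strict
    0#     ≈⟨ -‿inverseʳ x ⟨
    x - x  <⟨ +-monoˡ-< (- x) x<y ⟩
    y - x  ∎

  0<-⇒< : ∀ {x y} → 0# < y - x → x < y
  0<-⇒< {x} {y} 0<y-x = begin-strict
    x            ≈⟨ +-identityˡ x ⟨
    0# + x       <⟨ +-monoˡ-< x 0<y-x ⟩
    (y - x) + x  ≈⟨ //-rightDividesˡ x y ⟩
    y            ∎

  ≤⇒0≤- : ∀ {x y} → x ≤ y → 0# ≤ y - x
  ≤⇒0≤- (inj₁ x<y) = inj₁ (<⇒0<- x<y)
  ≤⇒0≤- {x} (inj₂ x≈y) = inj₂ (trans (sym (-‿inverseʳ x)) (+-congʳ x≈y))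

  -‿antimono-≤ : ∀ {x y} → x ≤ y → - y ≤ - x
  -‿antimono-≤ {x} {y} x≤y = begin
    - y          ≈⟨ xyx⁻¹≈y x (- y) ⟨
    x + - y - x  ≤⟨ +-monoˡ-≤ (- x) (+-monoˡ-≤ (- y) x≤y) ⟩
    y + - y - x  ≈⟨ +-congʳ (-‿inverseʳ y) ⟩
    0# - x       ≈⟨ +-identityˡ (- x) ⟩
    - x          ∎

  -‿<0 : ∀ {x} → 0# < x → - x < 0#
  -‿<0 {x} 0<x = begin-strict
    - x     ≈⟨ +-identityˡ (- x) ⟨
    0# - x  <⟨ +-monoˡ-< (- x) 0<x ⟩
    x - x   ≈⟨ -‿inverseʳ x ⟩
    0#      ∎

  *-monoʳ-< : ∀ {c x y} → 0# < c → x < y → c * x < c * y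
  *-monoʳ-< {c} {x} {y} 0<c x<y = 0<-⇒< (begin-strict
    0#             <⟨ *-pos 0<c (<⇒0<- x<y) ⟩
    c * (y - x)    ≈⟨ x[y-z]≈xy-xz c y x ⟩
    c * y - c * x  ∎)

  *-monoʳ-≤ : ∀ {c x y} → 0# ≤ c → x ≤ y → c * x ≤ c * y
  *-monoʳ-≤ _           (inj₂ x≈y) = inj₂ (*-congˡ x≈y)
  *-monoʳ-≤ (inj₁ 0<c)  (inj₁ x<y) = inj₁ (*-monoʳ-< 0<c x<y)
  *-monoʳ-≤ {c} {x} {y} (inj₂ 0≈c) (inj₁ _) = inj₂ (begin-equality
    c * x   ≈⟨ *-congʳ 0≈c ⟨
    0# * x  ≈⟨ zeroˡ x ⟩
    0#      ≈⟨ zeroˡ y ⟨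
    0# * y  ≈⟨ *-congʳ 0≈c ⟩
    c * y   ∎)

  *-monoˡ-≤ : ∀ {c x y} → 0# ≤ c → x ≤ y → x * c ≤ y * c
  *-monoˡ-≤ {c} {x} {y} 0≤c x≤y = begin
    x * c  ≈⟨ *-comm x c ⟩
    c * x  ≤⟨ *-monoʳ-≤ 0≤c x≤y ⟩
    c * y  ≈⟨ *-comm c y ⟩
    y * c  ∎

  *-mono-≤ : ∀ {a b x y} → 0# ≤ a → 0# ≤ x → a ≤ b → x ≤ y → a * x ≤ b * y
  *-mono-≤ {a} {b} {x} {y} 0≤a 0≤x a≤b x≤y = begin
    a * x  ≤⟨ *-monoʳ-≤ 0≤a x≤y ⟩
    a * y  ≤⟨ *-monoˡ-≤ (≤-trans 0≤x x≤y) a≤b ⟩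
    b * y  ∎

  *-nonNeg : ∀ {x y} → 0# ≤ x → 0# ≤ y → 0# ≤ x * y
  *-nonNeg {x} {y} 0≤x 0≤y = begin
    0#      ≈⟨ zeroʳ x ⟨
    x * 0#  ≤⟨ *-monoʳ-≤ 0≤x 0≤y ⟩
    x * y   ∎

  1≤* : ∀ {x y} → 1# ≤ x → 1# ≤ y → 1# ≤ x * y
  1≤* {x} {y} 1≤x 1≤y = begin
    1#       ≈⟨ *-identityʳ 1# ⟨
    1# * 1#  ≤⟨ *-mono-≤ 0≤1 0≤1 1≤x 1≤y ⟩
    x * y    ∎

  x≤m*x : ∀ {m x} → 1# ≤ m → 0# ≤ x → x ≤ m * x
  x≤m*x {m} {x} 1≤m 0≤x = begin
    x       ≈⟨ *-identityˡ x ⟨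
    1# * x  ≤⟨ *-monoˡ-≤ 0≤x 1≤m ⟩
    m * x   ∎

  fromℕ-nonNeg : ∀ n → 0# ≤ fromℕ F n
  fromℕ-nonNeg zero    = ≤-refl
  fromℕ-nonNeg (suc n) = ≤-trans 0≤1 (x≤x+y (fromℕ-nonNeg n))

  1≤fromℕ-suc : ∀ n → 1# ≤ fromℕ F (suc n)
  1≤fromℕ-suc n = x≤x+y (fromℕ-nonNeg n)

  fromℕ-mono-≤ : ∀ {m n} → m ≤ℕ n → fromℕ F m ≤ fromℕ F n
  fromℕ-mono-≤ {n = n} z≤n = fromℕ-nonNeg n
  fromℕ-mono-≤ (s≤s m≤n)    = +-monoʳ-≤ 1# (fromℕ-mono-≤ m≤n)

  pow-nonNeg : ∀ {x} → 0# ≤ x → ∀ n → 0# ≤ pow F x n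
  pow-nonNeg 0≤x zero    = 0≤1
  pow-nonNeg 0≤x (suc n) = *-nonNeg 0≤x (pow-nonNeg 0≤x n)

  1≤pow : ∀ {x} → 1# ≤ x → ∀ n → 1# ≤ pow F x n
  1≤pow 1≤x zero    = ≤-refl
  1≤pow 1≤x (suc n) = 1≤* 1≤x (1≤pow 1≤x n)

  pow-monoˡ-≤ : ∀ {x y} → 0# ≤ x → x ≤ y → ∀ n → pow F x n ≤ pow F y n
  pow-monoˡ-≤ 0≤x x≤y zero    = ≤-refl
  pow-monoˡ-≤ 0≤x x≤y (suc n) = *-mono-≤ 0≤x (pow-nonNeg 0≤x n) x≤y (pow-monoˡ-≤ 0≤x x≤y n)

  +-lower : ∀ {a a′ h h′ e e′} → a ≤ h + e → a′ ≤ h′ + e′ → a + a′ ≤ (h + h′) + (e + e′)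
  +-lower {h = h} {h′} {e} {e′} a≤h+e a′≤h′+e′ = begin
    _                        ≤⟨ +-mono-≤ a≤h+e a′≤h′+e′ ⟩
    (h + e) + (h′ + e′)      ≈⟨ interchange h e h′ e′ ⟩
    (h + h′) + (e + e′)      ∎

  *-lower : ∀ {m M a h e} → 1# ≤ m → m ≤ M → 0# ≤ a → 0# ≤ e → a ≤ h + e → a ≤ m * h + M * e
  *-lower {m} {M} {a} {h} {e} 1≤m m≤M 0≤a 0≤e a≤h+e = begin
    a              ≤⟨ x≤m*x 1≤m 0≤a ⟩
    m * a          ≤⟨ *-monoʳ-≤ (1≤⇒0≤ 1≤m) a≤h+e ⟩
    m * (h + e)    ≈⟨ distribˡ m h e ⟩
    m * h + m * e  ≤⟨ +-monoʳ-≤ (m * h) (*-monoˡ-≤ 0≤e m≤M) ⟩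
    m * h + M * e  ∎

  lower⇒pos : ∀ {a x e} → a ≤ x + e → e < a → 0# < x
  lower⇒pos {a} {x} {e} a≤x+e e<a = +-cancelʳ-< e (begin-strict
    0# + e  ≈⟨ +-identityˡ e ⟩
    e       <⟨ e<a ⟩
    a       ≤⟨ a≤x+e ⟩
    x + e   ∎)

  AbsLe-respˡ-≈ : ∀ {x y b} → x ≈ y → AbsLe F x b → AbsLe F y b
  AbsLe-respˡ-≈ x≈y (-b≤x , x≤b) = ≤-trans -b≤x (inj₂ x≈y) , ≤-trans (inj₂ (sym x≈y)) x≤b

  AbsLe-weaken : ∀ {x a b} → a ≤ b → AbsLe F x a → AbsLe F x b
  AbsLe-weaken a≤b (-a≤x , x≤a) = ≤-trans (-‿antimono-≤ a≤b) -a≤x , ≤-trans x≤a a≤b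

  AbsLe-zero : ∀ {b} → 0# ≤ b → AbsLe F 0# b
  AbsLe-zero 0≤b = ≤-trans (-‿antimono-≤ 0≤b) (inj₂ -0#≈0#) , 0≤b

  AbsLe-neg : ∀ {x b} → AbsLe F x b → AbsLe F (- x) b
  AbsLe-neg {x} {b} (-b≤x , x≤b) = -‿antimono-≤ x≤b , ≤-trans (-‿antimono-≤ -b≤x) (inj₂ (-‿involutive b))

  AbsLe-+ : ∀ {x y a b} → AbsLe F x a → AbsLe F y b → AbsLe F (x + y) (a + b)
  AbsLe-+ {x} {y} {a} {b} (-a≤x , x≤a) (-b≤y , y≤b) =
    ≤-trans (inj₂ (sym (-‿+-comm a b))) (+-mono-≤ -a≤x -b≤y) , +-mono-≤ x≤a y≤b

  AbsLe-* : ∀ {m x b} → 0# ≤ m → AbsLe F x b → AbsLe F (m * x) (m * b)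
  AbsLe-* {m} {x} {b} 0≤m (-b≤x , x≤b) =
    ≤-trans (inj₂ (-‿distribʳ-* m b)) (*-monoʳ-≤ 0≤m -b≤x) , *-monoʳ-≤ 0≤m x≤b

module Coefficients {c ℓ : Level} (F : OrderedField c ℓ) where
  open OrderedField F
  open OrderedFieldProperties F

  shift : (ℕ → Carrier) → ℕ → Carrier
  shift f zero    = 0#
  shift f (suc i) = f i

  shift-all : ∀ {p} (P : Carrier → Set p) → P 0# → ∀ {f} → (∀ j → P (f j)) → ∀ j → P (shift f j)
  shift-all P P0 Pf zero    = P0
  shift-all P P0 Pf (suc j) = Pf j

  shift-nonNeg : ∀ {h} → (∀ j → 0# ≤ h j) → ∀ j → 0# ≤ shift h j
  shift-nonNeg = shift-all (0# ≤_) ≤-refl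

  shift-pointwise : ∀ {p} (R : Carrier → Carrier → Set p) → R 0# 0# →
                    ∀ {f g} → (∀ j → R (f j) (g j)) → ∀ j → R (shift f j) (shift g j)
  shift-pointwise R R00 Rfg zero    = R00
  shift-pointwise R R00 Rfg (suc j) = Rfg j

  shift-lower : ∀ {a g e} → 0# ≤ e → (∀ j → a j ≤ g j + e) → ∀ j → shift a j ≤ shift g j + e
  shift-lower {e = e} 0≤e = shift-pointwise (λ u v → u ≤ v + e) (x≤x+y 0≤e)

  shift-cong : ∀ {f g} → (∀ j → f j ≈ g j) → ∀ j → shift f j ≈ shift g j
  shift-cong = shift-pointwise _≈_ refl

  shift-* : ∀ a f i → shift (λ j → a * f j) i ≈ a * shift f i
  shift-* a f zero    = sym (zeroʳ a)
  shift-* a f (suc i) = refl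

  shift-*-+ : ∀ a f g i → shift (λ j → a * f j + g j) i ≈ a * shift f i + shift g i
  shift-*-+ a f g zero    = sym (trans (+-identityʳ (a * 0#)) (zeroʳ a))
  shift-*-+ a f g (suc i) = refl

  coeff-addP : ∀ p r i → coeff F (addP F p r) i ≈ coeff F p i + coeff F r i
  coeff-addP []      r       i       = sym (+-identityˡ _)
  coeff-addP (a ∷ p) []      zero    = sym (+-identityʳ a)
  coeff-addP (a ∷ p) []      (suc i) = sym (+-identityʳ _)
  coeff-addP (a ∷ p) (b ∷ r) zero    = refl
  coeff-addP (a ∷ p) (b ∷ r) (suc i) = coeff-addP p r i

  coeff-map-* : ∀ a r i → coeff F (map (a *_) r) i ≈ a * coeff F r i
  coeff-map-* a []      i       = sym (zeroʳ a)
  coeff-map-* a (b ∷ r) zero    = refl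
  coeff-map-* a (b ∷ r) (suc i) = coeff-map-* a r i

  coeff-0∷ : ∀ p i → coeff F (0# ∷ p) i ≈ shift (coeff F p) i
  coeff-0∷ p zero    = refl
  coeff-0∷ p (suc i) = refl

  coeff-mulP-∷ : ∀ a p r i → coeff F (mulP F (a ∷ p) r) i ≈ a * coeff F r i + shift (coeff F (mulP F p r)) i
  coeff-mulP-∷ a p r i = trans (coeff-addP (map (a *_) r) (0# ∷ mulP F p r) i)
                               (+-cong (coeff-map-* a r i) (coeff-0∷ (mulP F p r) i))

  cubicMul : (a₀ a₁ a₂ a₃ : Carrier) → (ℕ → Carrier) → ℕ → Carrier
  cubicMul a₀ a₁ a₂ a₃ f i = a₀ * f i + (a₁ * shift f i + (a₂ * shift (shift f) i + a₃ * shift (shift (shift f)) i))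

  coeff-mulP-cubic : ∀ a₀ a₁ a₂ a₃ r i →
    coeff F (mulP F (a₀ ∷ a₁ ∷ a₂ ∷ a₃ ∷ []) r) i ≈ cubicMul a₀ a₁ a₂ a₃ (coeff F r) i
  coeff-mulP-cubic a₀ a₁ a₂ a₃ r i = begin-equality
    coeff F (mulP F (a₀ ∷ a₁ ∷ a₂ ∷ a₃ ∷ []) r) i
      ≈⟨ cons a₀ (a₁ ∷ a₂ ∷ a₃ ∷ []) cubic i ⟩
    a₀ * f i + shift (λ j → a₁ * f j + (a₂ * shift f j + a₃ * shift (shift f) j)) i
      ≈⟨ +-congˡ (shift-*-+ a₁ f _ i) ⟩
    a₀ * f i + (a₁ * shift f i + shift (λ j → a₂ * shift f j + a₃ * shift (shift f) j) i)
      ≈⟨ +-congˡ (+-congˡ (shift-*-+ a₂ (shift f) _ i)) ⟩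
    a₀ * f i + (a₁ * shift f i + (a₂ * shift (shift f) i + shift (λ j → a₃ * shift (shift f) j) i))
      ≈⟨ +-congˡ (+-congˡ (+-congˡ (shift-* a₃ (shift (shift f)) i))) ⟩
    cubicMul a₀ a₁ a₂ a₃ f i
      ∎
    where
    f : ℕ → Carrier
    f = coeff F r
    cons : ∀ a p {g} → (∀ j → coeff F (mulP F p r) j ≈ g j) → ∀ i → coeff F (mulP F (a ∷ p) r) i ≈ a * f i + shift g i
    cons a p p≈g i = trans (coeff-mulP-∷ a p r i) (+-congˡ (shift-cong p≈g i))
    linear : ∀ j → coeff F (mulP F (a₃ ∷ []) r) j ≈ a₃ * f j
    linear j = trans (cons a₃ [] (λ _ → refl) j) (trans (+-congˡ (shift-0 j)) (+-identityʳ _))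
      where
      shift-0 : ∀ j → shift (λ _ → 0#) j ≈ 0#
      shift-0 zero    = refl
      shift-0 (suc j) = refl
    quadratic : ∀ j → coeff F (mulP F (a₂ ∷ a₃ ∷ []) r) j ≈ a₂ * f j + a₃ * shift f j
    quadratic j = trans (cons a₂ (a₃ ∷ []) linear j) (+-congˡ (shift-* a₃ f j))
    cubic : ∀ j → coeff F (mulP F (a₁ ∷ a₂ ∷ a₃ ∷ []) r) j ≈ a₁ * f j + (a₂ * shift f j + a₃ * shift (shift f) j)
    cubic j = trans (cons a₁ (a₂ ∷ a₃ ∷ []) quadratic j) (+-congˡ (trans (shift-*-+ a₂ f _ j) (+-congˡ (shift-* a₃ (shift f) j))))

module Indicator {c ℓ : Level} (F : OrderedField c ℓ) where
  open OrderedField F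
  open OrderedFieldProperties F
  open Coefficients F
  import Relation.Binary.PropositionalEquality as ≡

  𝟙 : ∀ {p} {P : Set p} → Dec P → Carrier
  𝟙 (yes _) = 1#
  𝟙 (no _)  = 0#

  𝟙-nonNeg : ∀ {p} {P : Set p} (d : Dec P) → 0# ≤ 𝟙 d
  𝟙-nonNeg (yes _) = 0≤1
  𝟙-nonNeg (no _)  = ≤-refl

  𝟙-≤ : ∀ {p} {P : Set p} {x} → (P → 1# ≤ x) → 0# ≤ x → (d : Dec P) → 𝟙 d ≤ x
  𝟙-≤ 1≤x _   (yes p) = 1≤x p
  𝟙-≤ _   0≤x (no _)  = 0≤x

  𝟙-yes : ∀ {p} {P : Set p} → P → (d : Dec P) → 𝟙 d ≈ 1#
  𝟙-yes _ (yes _)  = refl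
  𝟙-yes p (no ¬p)  = contradiction p ¬p

  χ : ℕ → ℕ → Carrier
  χ n j = 𝟙 (posIndex? n j)

  χ-nonNeg : ∀ n j → 0# ≤ χ n j
  χ-nonNeg n j = 𝟙-nonNeg (posIndex? n j)

  χ-zero : ∀ j → χ 0 j ≤ coeff F (1# ∷ []) j
  χ-zero zero    = 𝟙-≤ (λ _ → ≤-refl) 0≤1 (posIndex? 0 0)
  χ-zero (suc j) = 𝟙-≤ (λ { (inj₁ ()) ; (inj₂ (_ , ())) }) ≤-refl (posIndex? 0 (suc j))

  χ-suc : ∀ n j → χ (suc n) j ≤ χ n j + (shift (shift (χ n)) j + shift (shift (shift (χ n))) j)
  χ-suc n j = 𝟙-≤ (one j) (+-nonNeg (χ-nonNeg n j) (+-nonNeg (χ₂-nonNeg j) (χ₃-nonNeg j))) (posIndex? (suc n) j)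
    where
    χ₂ χ₃ : ℕ → Carrier
    χ₂ = shift (shift (χ n))
    χ₃ = shift χ₂
    χ₂-nonNeg : ∀ j → 0# ≤ χ₂ j
    χ₂-nonNeg = shift-nonNeg (shift-nonNeg (χ-nonNeg n))
    χ₃-nonNeg : ∀ j → 0# ≤ χ₃ j
    χ₃-nonNeg = shift-nonNeg χ₂-nonNeg
    -- χ₂ (2 + k) and χ₃ (3 + k) compute to χ n k.
    one : ∀ j → PosIndex (suc n) j → 1# ≤ χ n j + (χ₂ j + χ₃ j)
    one zero _ = begin
      1#                      ≈⟨ 𝟙-yes (inj₁ ≡.refl) (posIndex? n 0) ⟨
      χ n 0                   ≤⟨ x≤x+y (+-nonNeg (χ₂-nonNeg 0) (χ₃-nonNeg 0)) ⟩
      χ n 0 + (χ₂ 0 + χ₃ 0)   ∎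
    one (suc zero) (inj₁ ())
    one (suc zero) (inj₂ (s≤s () , _))
    one (suc (suc k)) p with PosIndex-suc⁻¹ p
    ... | inj₁ k∈ = begin
      1#                      ≈⟨ 𝟙-yes k∈ (posIndex? n k) ⟨
      χ n k                   ≤⟨ x≤x+y (χ₃-nonNeg i) ⟩
      χ n k + χ₃ i            ≤⟨ x≤y+x (χ-nonNeg n i) ⟩
      χ n i + (χ n k + χ₃ i)  ∎
      where
      i : ℕ
      i = suc (suc k)
    ... | inj₂ (k′ , ≡.refl , k′∈) = begin
      1#                      ≈⟨ 𝟙-yes k′∈ (posIndex? n k′) ⟨
      χ n k′                  ≤⟨ x≤y+x (χ₂-nonNeg i) ⟩
      χ₂ i + χ n k′           ≤⟨ x≤y+x (χ-nonNeg n i) ⟩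
      χ n i + (χ₂ i + χ n k′) ∎
      where
      i : ℕ
      i = suc (suc (suc k′))

module Bounds {c ℓ : Level} (F : OrderedField c ℓ) where
  open OrderedField F
  open OrderedFieldProperties F
  open Coefficients F
  open Indicator F
  open RingProperties ring using (-‿distribˡ-*; x[y-z]≈xy-xz)
  open SemiringSolver commutativeSemiring using (solve; _:=_; con; _:+_; _:*_)

  zeroʳ-tail : ∀ x y → x * 0# + y * 0# ≈ 0#
  zeroʳ-tail x y = trans (+-cong (zeroʳ x) (zeroʳ y)) (+-identityʳ 0#)

  module Estimates (Q m₀ m₁ m₂ m₃ : Carrier) (1≤Q : 1# ≤ Q)
                   (1≤m₀ : 1# ≤ m₀) (m₀≤Q : m₀ ≤ Q) (1≤m₂ : 1# ≤ m₂) (m₂≤Q : m₂ ≤ Q)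
                   (1≤m₃ : 1# ≤ m₃) (m₃≤Q : m₃ ≤ Q) (0<m₁ : 0# < m₁) (m₁≤Q : m₁ ≤ Q) where

    K : Carrier
    K = fromℕ F 4 * Q

    E : ℕ → Carrier
    E n = m₁ * (fromℕ F n * pow F K n)

    tCoeff : ℕ → ℕ → Carrier
    tCoeff n = coeff F (powP F (tPoly F m₀ m₁ m₂ m₃) n)

    tMul : (ℕ → Carrier) → ℕ → Carrier
    tMul = cubicMul m₀ (- m₁) m₂ m₃

    tCoeff-suc : ∀ n i → tCoeff (suc n) i ≈ tMul (tCoeff n) i
    tCoeff-suc n = coeff-mulP-cubic m₀ (- m₁) m₂ m₃ (powP F (tPoly F m₀ m₁ m₂ m₃) n)

    0≤Q : 0# ≤ Q
    0≤Q = 1≤⇒0≤ 1≤Q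

    0≤m₀ : 0# ≤ m₀
    0≤m₀ = 1≤⇒0≤ 1≤m₀

    0<m₀ : 0# < m₀
    0<m₀ = begin-strict 0# <⟨ 0<1 ⟩ 1# ≤⟨ 1≤m₀ ⟩ m₀ ∎

    0≤m₁ : 0# ≤ m₁
    0≤m₁ = <⇒≤ 0<m₁

    0≤K : 0# ≤ K
    0≤K = *-nonNeg (fromℕ-nonNeg 4) 0≤Q

    E-nonNeg : ∀ n → 0# ≤ E n
    E-nonNeg n = *-nonNeg 0≤m₁ (*-nonNeg (fromℕ-nonNeg n) (pow-nonNeg 0≤K n))

    K*-expand : ∀ x → K * x ≈ Q * x + (Q * x + (Q * x + Q * x))
    K*-expand = solve 2 (λ Q x → (con 1 :+ (con 1 :+ (con 1 :+ (con 1 :+ con 0)))) :* Q :* x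
                                 := Q :* x :+ (Q :* x :+ (Q :* x :+ Q :* x))) refl Q

    E-suc : ∀ n → E (suc n) ≈ K * (m₁ * pow F K n + E n)
    E-suc n = solve 4 (λ m K B N → m :* ((con 1 :+ N) :* (K :* B)) := K :* (m :* B :+ m :* (N :* B)))
                      refl m₁ K (pow F K n) (fromℕ F n)

    tMul-bounded : ∀ {g b} → 0# ≤ b → (∀ j → AbsLe F (g j) b) → ∀ j → AbsLe F (tMul g j) (K * b)
    tMul-bounded {g} {b} 0≤b g≤b j =
      AbsLe-weaken sum≤Kb (AbsLe-+ (AbsLe-* 0≤m₀ (g≤b j)) (AbsLe-+ m₁-term
        (AbsLe-+ (AbsLe-* (1≤⇒0≤ 1≤m₂) (g₂≤b j)) (AbsLe-* (1≤⇒0≤ 1≤m₃) (g₃≤b j)))))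
      where
      shift-bounded : ∀ {h} → (∀ j → AbsLe F (h j) b) → ∀ j → AbsLe F (shift h j) b
      shift-bounded = shift-all (λ y → AbsLe F y b) (AbsLe-zero 0≤b)
      g₁≤b : ∀ j → AbsLe F (shift g j) b
      g₁≤b = shift-bounded g≤b
      g₂≤b : ∀ j → AbsLe F (shift (shift g) j) b
      g₂≤b = shift-bounded g₁≤b
      g₃≤b : ∀ j → AbsLe F (shift (shift (shift g)) j) b
      g₃≤b = shift-bounded g₂≤b
      m₁-term : AbsLe F (- m₁ * shift g j) (m₁ * b)
      m₁-term = AbsLe-respˡ-≈ (-‿distribˡ-* m₁ (shift g j)) (AbsLe-neg (AbsLe-* 0≤m₁ (g₁≤b j)))
      sum≤Kb : m₀ * b + (m₁ * b + (m₂ * b + m₃ * b)) ≤ K * b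
      sum≤Kb = begin
        m₀ * b + (m₁ * b + (m₂ * b + m₃ * b))  ≤⟨ +-mono-≤ (≤Qb m₀≤Q) (+-mono-≤ (≤Qb m₁≤Q) (+-mono-≤ (≤Qb m₂≤Q) (≤Qb m₃≤Q))) ⟩
        Q * b + (Q * b + (Q * b + Q * b))      ≈⟨ K*-expand b ⟨
        K * b                                  ∎
        where
        ≤Qb : ∀ {m} → m ≤ Q → m * b ≤ Q * b
        ≤Qb = *-monoˡ-≤ 0≤b

    -m₁-lower : ∀ {h b x} → h ≤ b → m₁ * b ≤ x → 0# ≤ - m₁ * h + x
    -m₁-lower {h} {b} {x} h≤b m₁b≤x = begin
      0#                      ≤⟨ *-nonNeg 0≤m₁ (≤⇒0≤- h≤b) ⟩
      m₁ * (b - h)            ≈⟨ x[y-z]≈xy-xz m₁ b h ⟩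
      m₁ * b - m₁ * h         ≈⟨ +-comm (m₁ * b) _ ⟩
      - (m₁ * h) + m₁ * b     ≈⟨ +-congʳ (-‿distribˡ-* m₁ h) ⟩
      - m₁ * h + m₁ * b       ≤⟨ +-monoʳ-≤ _ m₁b≤x ⟩
      - m₁ * h + x            ∎

    -- Each of the four terms of tMul g j loses at most Q x, where x = m₁ b + e, and 4 Q x = K x.
    tMul-lower : ∀ {a g b e} → 0# ≤ b → 0# ≤ e → (∀ j → 0# ≤ a j) → (∀ j → g j ≤ b) → (∀ j → a j ≤ g j + e) →
                 ∀ j → a j + (shift (shift a) j + shift (shift (shift a)) j) ≤ tMul g j + K * (m₁ * b + e)
    tMul-lower {a} {g} {b} {e} 0≤b 0≤e 0≤a g≤b a≤g+e j = begin
      a j + (a₂ j + a₃ j)                              ≈⟨ +-congˡ (+-identityˡ _) ⟨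
      a j + (0# + (a₂ j + a₃ j))                       ≤⟨ +-lower (term 1≤m₀ m₀≤Q (0≤a j) (a≤g+e j))
                                                            (+-lower (-m₁-lower (shift-all (_≤ b) 0≤b g≤b j) m₁b≤Qx)
                                                            (+-lower (term 1≤m₂ m₂≤Q (0≤a₂ j) (a₂≤g₂+e j))
                                                                     (term 1≤m₃ m₃≤Q (0≤a₃ j) (a₃≤g₃+e j)))) ⟩
      tMul g j + (Q * x + (Q * x + (Q * x + Q * x)))   ≈⟨ +-congˡ (K*-expand x) ⟨
      tMul g j + K * x                                 ∎
      where
      x : Carrier
      x = m₁ * b + e
      a₂ a₃ g₂ g₃ : ℕ → Carrier
      a₂ = shift (shift a)
      a₃ = shift a₂
      g₂ = shift (shift g)
      g₃ = shift g₂
      a₂≤g₂+e : ∀ j → a₂ j ≤ g₂ j + e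
      a₂≤g₂+e = shift-lower 0≤e (shift-lower 0≤e a≤g+e)
      a₃≤g₃+e : ∀ j → a₃ j ≤ g₃ j + e
      a₃≤g₃+e = shift-lower 0≤e a₂≤g₂+e
      0≤a₂ : ∀ j → 0# ≤ a₂ j
      0≤a₂ = shift-nonNeg (shift-nonNeg 0≤a)
      0≤a₃ : ∀ j → 0# ≤ a₃ j
      0≤a₃ = shift-nonNeg 0≤a₂
      0≤m₁b : 0# ≤ m₁ * b
      0≤m₁b = *-nonNeg 0≤m₁ 0≤b
      m₁b≤Qx : m₁ * b ≤ Q * x
      m₁b≤Qx = ≤-trans (x≤x+y 0≤e) (x≤m*x 1≤Q (+-nonNeg 0≤m₁b 0≤e))
      term : ∀ {m a′ h} → 1# ≤ m → m ≤ Q → 0# ≤ a′ → a′ ≤ h + e → a′ ≤ m * h + Q * x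
      term {m} {h = h} 1≤m m≤Q 0≤a′ a′≤h+e =
        ≤-trans (*-lower 1≤m m≤Q 0≤a′ 0≤e a′≤h+e) (+-monoʳ-≤ (m * h) (*-monoʳ-≤ 0≤Q (x≤y+x 0≤m₁b)))

    tCoeff-bounded : ∀ n i → AbsLe F (tCoeff n i) (pow F K n)
    tCoeff-bounded zero    zero    = ≤-trans (proj₁ (AbsLe-zero 0≤1)) 0≤1 , ≤-refl
    tCoeff-bounded zero    (suc i) = AbsLe-zero 0≤1
    tCoeff-bounded (suc n) i       = AbsLe-respˡ-≈ (sym (tCoeff-suc n i))
                                       (tMul-bounded (pow-nonNeg 0≤K n) (tCoeff-bounded n) i)

    tCoeff-lower : ∀ n i → χ n i ≤ tCoeff n i + E n
    tCoeff-lower zero    i = ≤-trans (χ-zero i) (x≤x+y (E-nonNeg 0))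
    tCoeff-lower (suc n) i = begin
      χ (suc n) i                                         ≤⟨ χ-suc n i ⟩
      χ n i + (shift (shift (χ n)) i + shift (shift (shift (χ n))) i)
        ≤⟨ tMul-lower (pow-nonNeg 0≤K n) (E-nonNeg n) (χ-nonNeg n) (λ j → proj₂ (tCoeff-bounded n j)) (tCoeff-lower n) i ⟩
      tMul (tCoeff n) i + K * (m₁ * pow F K n + E n)      ≈⟨ +-cong (tCoeff-suc n i) (E-suc n) ⟨
      tCoeff (suc n) i + E (suc n)                        ∎

    tCoeff-pos : ∀ n {i} → E n < 1# → PosIndex n i → 0# < tCoeff n i
    tCoeff-pos n {i} E<1 i∈ = lower⇒pos (begin
      1#                  ≈⟨ 𝟙-yes i∈ (posIndex? n i) ⟨
      χ n i               ≤⟨ tCoeff-lower n i ⟩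
      tCoeff n i + E n    ∎) E<1

    tMul-at-0 : ∀ g → tMul g 0 ≈ m₀ * g 0
    tMul-at-0 g = begin-equality
      m₀ * g 0 + (- m₁ * 0# + (m₂ * 0# + m₃ * 0#))  ≈⟨ +-congˡ (+-cong (zeroʳ (- m₁)) (zeroʳ-tail m₂ m₃)) ⟩
      m₀ * g 0 + (0# + 0#)                          ≈⟨ +-congˡ (+-identityʳ 0#) ⟩
      m₀ * g 0 + 0#                                 ≈⟨ +-identityʳ _ ⟩
      m₀ * g 0                                      ∎

    tMul-at-1 : ∀ g → tMul g 1 ≈ m₀ * g 1 + - m₁ * g 0
    tMul-at-1 g = +-congˡ (trans (+-congˡ (zeroʳ-tail m₂ m₃)) (+-identityʳ _))

    tMul-linear-neg : ∀ {g} → g 1 ≤ 0# → 0# < g 0 → tMul g 1 < 0#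
    tMul-linear-neg {g} g₁≤0 0<g₀ = begin-strict
      tMul g 1                  ≈⟨ tMul-at-1 g ⟩
      m₀ * g 1 + - m₁ * g 0     <⟨ +-mono-≤-< m₀g₁≤0 -m₁g₀<0 ⟩
      0# + 0#                   ≈⟨ +-identityʳ 0# ⟩
      0#                        ∎
      where
      m₀g₁≤0 : m₀ * g 1 ≤ 0#
      m₀g₁≤0 = ≤-trans (*-monoʳ-≤ 0≤m₀ g₁≤0) (inj₂ (zeroʳ m₀))
      -m₁g₀<0 : - m₁ * g 0 < 0#
      -m₁g₀<0 = <-respˡ-≈ (-‿distribˡ-* m₁ (g 0)) (-‿<0 (*-pos 0<m₁ 0<g₀))

    tCoeff-const-pos : ∀ n → 0# < tCoeff n 0
    tCoeff-const-pos zero    = 0<1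
    tCoeff-const-pos (suc n) = <-respʳ-≈ (sym (trans (tCoeff-suc n 0) (tMul-at-0 (tCoeff n))))
                                         (*-pos 0<m₀ (tCoeff-const-pos n))

    tCoeff-linear-neg : ∀ n → tCoeff (suc n) 1 < 0#

    tCoeff-linear-nonPos : ∀ n → tCoeff n 1 ≤ 0#
    tCoeff-linear-nonPos zero    = ≤-refl
    tCoeff-linear-nonPos (suc n) = <⇒≤ (tCoeff-linear-neg n)

    tCoeff-linear-neg n = <-respˡ-≈ (sym (tCoeff-suc n 1))
                            (tMul-linear-neg {tCoeff n} (tCoeff-linear-nonPos n) (tCoeff-const-pos n))

open Defs using (_≤_)

lemma2p1 : ∀ {c ℓ : Level} (F : OrderedField c ℓ) → let open OrderedField F in
    (q l : ℕ) → 2 ≤ℕ q → 1 ≤ℕ l →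
    (m₀ m₁ m₂ m₃ : Carrier) →
    _≤_ F 1# m₀ → m₀ < fromℕ F q →
    _≤_ F 1# m₂ → m₂ < fromℕ F q →
    _≤_ F 1# m₃ → m₃ < fromℕ F q →
    0# < m₁ → m₁ * (fromℕ F l * pow F (fromℕ F 6 * fromℕ F q) l) < 1# →
    (0# < coeff F (powP F (tPoly F m₀ m₁ m₂ m₃) l) 0)
    × (∀ i → 2 ≤ℕ i → i ≤ℕ 3 *ℕ l → 0# < coeff F (powP F (tPoly F m₀ m₁ m₂ m₃) l) i)
    × (coeff F (powP F (tPoly F m₀ m₁ m₂ m₃) l) 1 < 0#)
    × (∀ i → i ≤ℕ 3 *ℕ l → AbsLe F (coeff F (powP F (tPoly F m₀ m₁ m₂ m₃) l) i) (pow F (fromℕ F 4 * fromℕ F q) l))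
lemma2p1 F (suc q) (suc l) _ _ m₀ m₁ m₂ m₃ 1≤m₀ m₀<Q 1≤m₂ m₂<Q 1≤m₃ m₃<Q 0<m₁ m₁W<1 =
    tCoeff-const-pos (suc l)
  , (λ i 2≤i i≤3l → tCoeff-pos (suc l) E<1 (inj₂ (2≤i , i≤3l)))
  , tCoeff-linear-neg l
  , λ i _ → tCoeff-bounded (suc l) i
  where
  open OrderedField F
  open OrderedFieldProperties F hiding (_≤_)
  Q 6Q W : Carrier
  Q  = fromℕ F (suc q)
  6Q = fromℕ F 6 * Q
  W  = fromℕ F (suc l) * pow F 6Q (suc l)
  1≤Q : _≤_ F 1# Q
  1≤Q = 1≤fromℕ-suc q
  1≤W : _≤_ F 1# W
  1≤W = 1≤* (1≤fromℕ-suc l) (1≤pow (1≤* (1≤fromℕ-suc 5) 1≤Q) (suc l))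
  m₁≤Q : _≤_ F m₁ Q
  m₁≤Q = begin
    m₁       ≈⟨ *-identityʳ m₁ ⟨
    m₁ * 1#  ≤⟨ *-monoʳ-≤ (<⇒≤ 0<m₁) 1≤W ⟩
    m₁ * W   <⟨ m₁W<1 ⟩
    1#       ≤⟨ 1≤Q ⟩
    Q        ∎
  open Bounds.Estimates F Q m₀ m₁ m₂ m₃ 1≤Q 1≤m₀ (<⇒≤ m₀<Q) 1≤m₂ (<⇒≤ m₂<Q) 1≤m₃ (<⇒≤ m₃<Q) 0<m₁ m₁≤Q
  E<1 : E (suc l) < 1#
  E<1 = begin-strict
    E (suc l)  ≤⟨ *-monoʳ-≤ (<⇒≤ 0<m₁) (*-monoʳ-≤ (fromℕ-nonNeg (suc l)) (pow-monoˡ-≤ 0≤K K≤6Q (suc l))) ⟩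
    m₁ * W     <⟨ m₁W<1 ⟩
    1#         ∎
    where
    K≤6Q : _≤_ F K 6Q
    K≤6Q = *-monoˡ-≤ (1≤⇒0≤ 1≤Q) (fromℕ-mono-≤ (m≤m+n 4 2))
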